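{- Let $q$ be a prime power, $t\ge2$, $n=3t$, $s$ a positive integer coprime with $n$, and $\delta\in\mathbb{F}_{q^{3t}}$. If $\mathrm{Tr}_{q^{3t}/q^t}(\delta)-\mathrm{N}_{q^{3t}/q^t}(\delta)\neq2$, then $f(x)=x^{q^s}+x^{q^{t+s}}+\delta x^{q^{2t+s}}$ is an R-$q^t$-partially scattered $q$-polynomial.
   Context: $\mathrm{Tr}_{q^{3t}/q^t}(x)=x+x^{q^t}+x^{q^{2t}}$ and $\mathrm{N}_{q^{3t}/q^t}(x)=x^{1+q^t+q^{2t}}$. A $q$-polynomial $f$ over $\mathbb{F}_{q^n}$ is R-$q^t$-partially scattered if for all $y,z\in\mathbb{F}_{q^n}^*$, $f(y)/y=f(z)/z$ and $y/z\in\mathbb{F}_{q^t}$ imply $y/z\in\mathbb{F}_q$. -}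

module Defs where

open import Level using (Level; 0ℓ)
open import Data.Nat as ℕ using (ℕ; zero; suc; _≥_)
open import Data.Nat.Primality using (Prime)
open import Data.Product using (Σ; ∃; _×_)
open import Data.Fin using (Fin)
open import Relation.Binary.PropositionalEquality using (_≡_; _≢_)
open import Relation.Nullary using (¬_)
open import Algebra.Structures using (IsCommutativeRing)
open import Function.Bundles using (_↔_)

IsPrimePower : ℕ → Set
IsPrimePower q = Σ ℕ λ p → Σ ℕ λ k → Prime p × k ≥ 1 × q ≡ p ℕ.^ k

-- A finite field with exactly N elements (equality is propositional equality).
-- Any such field is (isomorphic to) F_N.
record FiniteField (N : ℕ) : Set₁ where
  infixl 7 _*_
  infixl 6 _+_
  field
    Carrier : Set
    _+_ _*_ : Carrier → Carrier → Carrier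
    -_      : Carrier → Carrier
    0# 1#   : Carrier
    _⁻¹     : Carrier → Carrier
    isCommutativeRing : IsCommutativeRing _≡_ _+_ _*_ -_ 0# 1#
    0≢1     : 0# ≢ 1#
    ⁻¹-inverse : ∀ x → x ≢ 0# → x * (x ⁻¹) ≡ 1#
    card    : Carrier ↔ Fin N

  _-_ : Carrier → Carrier → Carrier
  x - y = x + (- y)

  _^_ : Carrier → ℕ → Carrier
  x ^ zero  = 1#
  x ^ suc m = x * (x ^ m)

  2# : Carrier
  2# = 1# + 1#

module _ {N : ℕ} (F : FiniteField N) (q : ℕ) where
  open FiniteField F

  InSubfield : ℕ → Carrier → Set
  InSubfield e x = x ^ (q ℕ.^ e) ≡ x

  Tr : ℕ → Carrier → Carrier
  Tr t x = x + x ^ (q ℕ.^ t) + x ^ (q ℕ.^ (2 ℕ.* t))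

  Nm : ℕ → Carrier → Carrier
  Nm t x = x ^ (1 ℕ.+ q ℕ.^ t ℕ.+ q ℕ.^ (2 ℕ.* t))

  RPartiallyScattered : ℕ → (Carrier → Carrier) → Set
  RPartiallyScattered t f =
    ∀ y z → y ≢ 0# → z ≢ 0# →
      f y * (y ⁻¹) ≡ f z * (z ⁻¹) →
      InSubfield t (y * (z ⁻¹)) →
      InSubfield 1 (y * (z ⁻¹))

  fPoly : ℕ → ℕ → Carrier → Carrier → Carrier
  fPoly t s δ x = x ^ (q ℕ.^ s) + x ^ (q ℕ.^ (t ℕ.+ s)) + δ * x ^ (q ℕ.^ (2 ℕ.* t ℕ.+ s))

module Submission where

-- Write σₑ(x) = x^(q^e). As |F| = q^(3t) = p^(3tk), F has characteristic p, so every σₑ is a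
-- ring endomorphism, and σₜ³ = id by Fermat. Then f = L ∘ σₛ with L(w) = w + σₜ(w) + δ σₜ²(w),
-- and L is F_{q^t}-linear, so f(λx) = σₛ(λ) f(x) for λ ∈ F_{q^t}. If f(y)/y = f(z)/z and
-- λ = y/z ∈ F_{q^t}, then σₛ(λ) f(z) = f(y) = λ f(z). Moreover f(z) ≠ 0: applying σₜ twice to
-- L(w) = 0 gives a linear system in w, σₜ(w), σₜ²(w) with determinant 2 + N(δ) − Tr(δ) ≠ 0.
-- Hence σₛ(λ) = λ = σₜ(λ), and Bézout for gcd(s, t) = 1 gives λ ∈ F_q.

open import Level using (0ℓ)
open import Data.Nat as ℕ using (ℕ; zero; suc; _<_; s≤s; z≤n)
import Data.Nat.Properties as ℕ
open import Data.Nat.Combinatorics using (_C_; nCn≡1; nC1≡n; nCk+nC[k+1]≡[n+1]C[k+1])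
open import Data.Nat.Divisibility using (_∣_; divides; >⇒∤; ∣-trans; n∣m*n)
open import Data.Nat.Primality using (Prime; euclidsLemma)
open import Data.Nat.Coprimality using (Coprime; coprime-Bézout)
open import Data.Nat.GCD using (module Bézout)
open import Data.Nat.Solver using (module +-*-Solver)
open import Data.Product using (_,_)
open import Data.Sum using (inj₁; inj₂)
open import Data.Empty using (⊥-elim)
open import Data.Fin using (Fin; toℕ; inject₁; punchIn)
import Data.Fin as Fin
import Data.Fin.Properties as Fin
open import Data.Vec.Functional using (init; last)
open import Function using (_∘_; _↔_; Inverse; mk↔ₛ′)
open import Function.Properties.Inverse using (↔-sym; ↔-trans)
open import Relation.Nullary using (yes; no)
open import Relation.Binary.Definitions using (DecidableEquality)
import Relation.Binary.Reasoning.Setoid as ≈-Reasoning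
open import Algebra.Core using (Op₁; Op₂)
open import Algebra.Bundles using (CommutativeMonoid; AbelianGroup; CommutativeRing)
open import Algebra.Structures using (IsAbelianGroup)
import Algebra.Properties.CommutativeMonoid.Sum as CommutativeMonoidSum
import Algebra.Properties.AbelianGroup as AbelianGroupProperties
import Algebra.Properties.Ring as RingProperties
open import Relation.Binary.PropositionalEquality using (_≡_; _≢_; refl; sym; trans; cong; cong₂; subst; module ≡-Reasoning)
open import Defs

[k+1]*[n+1]C[k+1]≡[n+1]*nCk : ∀ n k → suc k ℕ.* (suc n C suc k) ≡ suc n ℕ.* (n C k)
[k+1]*[n+1]C[k+1]≡[n+1]*nCk zero zero = refl
[k+1]*[n+1]C[k+1]≡[n+1]*nCk zero (suc k) = ℕ.*-zeroʳ (suc (suc k))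
[k+1]*[n+1]C[k+1]≡[n+1]*nCk (suc n) zero = trans (ℕ.+-identityʳ _) (trans (nC1≡n (suc (suc n))) (sym (ℕ.*-identityʳ _)))
[k+1]*[n+1]C[k+1]≡[n+1]*nCk (suc n) (suc k) = begin
  suc (suc k) ℕ.* (suc (suc n) C suc (suc k))
    ≡⟨ cong (suc (suc k) ℕ.*_) (sym (nCk+nC[k+1]≡[n+1]C[k+1] (suc n) (suc k))) ⟩
  suc (suc k) ℕ.* (A ℕ.+ B)
    ≡⟨ solve 3 (λ k A B → (con 2 :+ k) :* (A :+ B) := (con 1 :+ k) :* A :+ A :+ (con 2 :+ k) :* B) refl k A B ⟩
  suc k ℕ.* A ℕ.+ A ℕ.+ suc (suc k) ℕ.* B
    ≡⟨ cong₂ (λ u v → u ℕ.+ A ℕ.+ v) ([k+1]*[n+1]C[k+1]≡[n+1]*nCk n k) ([k+1]*[n+1]C[k+1]≡[n+1]*nCk n (suc k)) ⟩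
  suc n ℕ.* (n C k) ℕ.+ A ℕ.+ suc n ℕ.* (n C suc k)
    ≡⟨ solve 4 (λ n a b A → (con 1 :+ n) :* a :+ A :+ (con 1 :+ n) :* b := (con 1 :+ n) :* (a :+ b) :+ A) refl n (n C k) (n C suc k) A ⟩
  suc n ℕ.* (n C k ℕ.+ n C suc k) ℕ.+ A
    ≡⟨ cong (λ c → suc n ℕ.* c ℕ.+ A) (nCk+nC[k+1]≡[n+1]C[k+1] n k) ⟩
  suc n ℕ.* A ℕ.+ A
    ≡⟨ ℕ.+-comm (suc n ℕ.* A) A ⟩
  suc (suc n) ℕ.* A ∎
  where
  open ≡-Reasoning
  open +-*-Solver
  A = suc n C suc k
  B = suc n C suc (suc k)

p∣pCk : ∀ {p k} → Prime p → 0 < k → k < p → p ∣ p C k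
p∣pCk {suc n} {suc k} p-prime _ k<p
  with euclidsLemma (suc k) (suc n C suc k) p-prime
         (divides (n C k) (trans ([k+1]*[n+1]C[k+1]≡[n+1]*nCk n k) (ℕ.*-comm (suc n) (n C k))))
... | inj₁ p∣k+1 = ⊥-elim (>⇒∤ k<p p∣k+1)
... | inj₂ p∣pCk = p∣pCk

module _ {c ℓ} (M : CommutativeMonoid c ℓ) where
  open CommutativeMonoid M using (Carrier; _≈_; setoid)
  open CommutativeMonoidSum M using (sum; sum-permute; sum-cong-≗)
  open Inverse using (to; from; strictlyInverseʳ)

  sum-reindex : ∀ {a} {A : Set a} {n} (e : A ↔ Fin n) (π : A ↔ A) (g : A → Carrier) →
                sum (g ∘ from e) ≈ sum (g ∘ to π ∘ from e)
  sum-reindex e π g = begin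
    sum (g ∘ from e)                                   ≈⟨ sum-permute (g ∘ from e) (↔-trans (↔-sym e) (↔-trans π e)) ⟩
    sum (g ∘ from e ∘ to e ∘ to π ∘ from e)            ≡⟨ sum-cong-≗ (λ i → cong g (strictlyInverseʳ e (to π (from e i)))) ⟩
    sum (g ∘ to π ∘ from e)                            ∎
    where open ≈-Reasoning setoid

module CommutativeRingProperties {c ℓ} (R : CommutativeRing c ℓ) where
  open CommutativeRing R hiding (refl; sym; trans)
  private module ≈ = CommutativeRing R
  open import Algebra.Properties.Semiring.Mult semiring using (_×_; ×1-homo-*; ×-assoc-*; ×-homo-1; ×-congʳ)
  open import Algebra.Properties.Semiring.Exp semiring using (_^_)
  open import Algebra.Properties.Monoid.Sum +-monoid using (sum; sum-init-last; sum-cong-≋; sum-replicate-zero)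
  open import Algebra.Properties.CommutativeSemiring.Binomial commutativeSemiring using (theorem; binomialTerm)
  open import Algebra.Solver.Ring.NaturalCoefficients.Default commutativeSemiring
  open import Relation.Binary.Reasoning.Setoid setoid

  ×1-homo-^ : ∀ m n → (m ℕ.^ n) × 1# ≈ (m × 1#) ^ n
  ×1-homo-^ m zero    = +-identityʳ 1#
  ×1-homo-^ m (suc n) = ≈.trans (×1-homo-* m (m ℕ.^ n)) (*-congˡ (×1-homo-^ m n))

  char∣⇒×≈0 : ∀ {p m} → p × 1# ≈ 0# → p ∣ m → ∀ x → m × x ≈ 0#
  char∣⇒×≈0 {p} char (divides d refl) x = begin
    (d ℕ.* p) × x              ≈⟨ ×-congʳ (d ℕ.* p) (≈.sym (*-identityˡ x)) ⟩
    (d ℕ.* p) × (1# * x)       ≈⟨ ≈.sym (×-assoc-* (d ℕ.* p) 1# x) ⟩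
    ((d ℕ.* p) × 1#) * x       ≈⟨ *-congʳ (×1-homo-* d p) ⟩
    ((d × 1#) * (p × 1#)) * x  ≈⟨ *-congʳ (*-congˡ char) ⟩
    ((d × 1#) * 0#) * x        ≈⟨ ≈.trans (*-congʳ (zeroʳ _)) (zeroˡ x) ⟩
    0# ∎

  frobenius-additive : ∀ {p} → Prime p → p × 1# ≈ 0# → ∀ x y → (x + y) ^ p ≈ x ^ p + y ^ p
  frobenius-additive {p@(suc m)} p-prime char x y = begin
    (x + y) ^ p                                          ≈⟨ theorem p x y ⟩
    term Fin.zero + sum (term ∘ Fin.suc)                 ≈⟨ +-congˡ (sum-init-last (term ∘ Fin.suc)) ⟩
    term Fin.zero + (sum (init (term ∘ Fin.suc)) + last (term ∘ Fin.suc))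
                                                         ≈⟨ +-congˡ (+-cong middle top) ⟩
    term Fin.zero + (0# + x ^ p)                         ≈⟨ +-cong bottom (+-identityˡ _) ⟩
    y ^ p + x ^ p                                        ≈⟨ +-comm _ _ ⟩
    x ^ p + y ^ p                                        ∎
    where
    term = binomialTerm x y p
    term-at : ∀ k (i : Fin (suc p)) → toℕ i ≡ k → term i ≈ (p C k) × (x ^ k * y ^ (p ℕ.∸ k))
    term-at _ i refl = ≈.refl
    bottom : term Fin.zero ≈ y ^ p
    bottom = ≈.trans (×-homo-1 _) (*-identityˡ _)
    top : last (term ∘ Fin.suc) ≈ x ^ p
    top = begin
      last (term ∘ Fin.suc)                  ≈⟨ term-at p (Fin.suc (Fin.fromℕ m)) (cong suc (Fin.toℕ-fromℕ m)) ⟩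
      (p C p) × (x ^ p * y ^ (p ℕ.∸ p))      ≡⟨ cong₂ (λ c e → c × (x ^ p * y ^ e)) (nCn≡1 p) (ℕ.n∸n≡0 p) ⟩
      1 × (x ^ p * 1#)                       ≈⟨ ≈.trans (×-homo-1 _) (*-identityʳ _) ⟩
      x ^ p                                  ∎
    middle : sum (init (term ∘ Fin.suc)) ≈ 0#
    middle = ≈.trans (sum-cong-≋ λ j → ≈.trans (term-at _ (Fin.suc (inject₁ j)) (cong suc (Fin.toℕ-inject₁ j)))
                                          (char∣⇒×≈0 char (p∣pCk p-prime (s≤s z≤n) (s≤s (Fin.toℕ<n j))) _))
                   (sum-replicate-zero m)

  cyclic-system : ∀ {d d₁ d₂ w w₁ w₂} →
                  w + w₁ + d * w₂ ≈ 0# → w₁ + w₂ + d₁ * w ≈ 0# → w₂ + w + d₂ * w₁ ≈ 0# →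
                  (d + d₁ + d₂) * w ≈ (1# + 1# + d * d₁ * d₂) * w
  cyclic-system {d} {d₁} {d₂} {w} {w₁} {w₂} e₀ e₁ e₂ = begin
    (d + d₁ + d₂) * w                                              ≈⟨ ≈.sym (vanish _ 1# (d * d₂) 1#) ⟩
    (d + d₁ + d₂) * w + 1# * E₀ + d * d₂ * E₁ + 1# * E₂             ≈⟨ expand ⟩
    (1# + 1# + d * d₁ * d₂) * w + d₂ * E₀ + 1# * E₁ + d * E₂        ≈⟨ vanish _ d₂ 1# d ⟩
    (1# + 1# + d * d₁ * d₂) * w                                    ∎
    where
    E₀ = w + w₁ + d * w₂
    E₁ = w₁ + w₂ + d₁ * w
    E₂ = w₂ + w + d₂ * w₁
    vanish : ∀ a b c e → a + b * E₀ + c * E₁ + e * E₂ ≈ a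
    vanish a b c e = ≈.trans (+-cong (+-cong (+-congˡ (*-congˡ e₀)) (*-congˡ e₁)) (*-congˡ e₂))
      (solve 4 (λ a b c e → a :+ b :* con 0 :+ c :* con 0 :+ e :* con 0 := a) ≈.refl a b c e)
    expand : (d + d₁ + d₂) * w + 1# * E₀ + d * d₂ * E₁ + 1# * E₂
           ≈ (1# + 1# + d * d₁ * d₂) * w + d₂ * E₀ + 1# * E₁ + d * E₂
    expand = solve 6 (λ d d₁ d₂ w w₁ w₂ →
      (d :+ d₁ :+ d₂) :* w :+ con 1 :* (w :+ w₁ :+ d :* w₂) :+ d :* d₂ :* (w₁ :+ w₂ :+ d₁ :* w) :+ con 1 :* (w₂ :+ w :+ d₂ :* w₁)
      := (con 1 :+ con 1 :+ d :* d₁ :* d₂) :* w :+ d₂ :* (w :+ w₁ :+ d :* w₂) :+ con 1 :* (w₁ :+ w₂ :+ d₁ :* w) :+ d :* (w₂ :+ w :+ d₂ :* w₁))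
      ≈.refl d d₁ d₂ w w₁ w₂

module _ {a} {A : Set a} {_∙_ : Op₂ A} {ε : A} {_⁻¹ : Op₁ A}
         (isAbelianGroup : IsAbelianGroup _≡_ _∙_ ε _⁻¹) where
  private
    G : AbelianGroup a a
    G = record { isAbelianGroup = isAbelianGroup }
  open AbelianGroup G using (commutativeMonoid; assoc; inverseˡ; inverseʳ; identityˡ)
  open AbelianGroupProperties G using (identityˡ-unique)
  open CommutativeMonoidSum commutativeMonoid using (sum; ∑-distrib-+; sum-replicate)
  open import Algebra.Properties.Monoid.Mult (AbelianGroup.monoid G) using (_×_)
  open Inverse using (from)

  ×-card≡ε : ∀ {n} → A ↔ Fin n → ∀ x → n × x ≡ ε
  ×-card≡ε {n} e x = identityˡ-unique (n × x) (sum (from e)) (sym (begin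
    sum (from e)                        ≡⟨ sum-reindex commutativeMonoid e translation (λ y → y) ⟩
    sum (λ i → x ∙ from e i)            ≡⟨ ∑-distrib-+ {n} (λ _ → x) (from e) ⟩
    sum {n} (λ _ → x) ∙ sum (from e)    ≡⟨ cong (_∙ sum (from e)) (sum-replicate n) ⟩
    (n × x) ∙ sum (from e)              ∎))
    where
    open ≡-Reasoning
    translation : A ↔ A
    translation = mk↔ₛ′ (x ∙_) (x ⁻¹ ∙_)
      (λ y → trans (sym (assoc x (x ⁻¹) y)) (trans (cong (_∙ y) (inverseʳ x)) (identityˡ y)))
      (λ y → trans (sym (assoc (x ⁻¹) x y)) (trans (cong (_∙ y) (inverseˡ x)) (identityˡ y)))

module FiniteFieldProperties {N : ℕ} (F : FiniteField N) where
  open FiniteField F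
  open Inverse using (to; from; strictlyInverseʳ; strictlyInverseˡ)

  ring : CommutativeRing 0ℓ 0ℓ
  ring = record { isCommutativeRing = isCommutativeRing }

  open CommutativeRing ring public
    using ( +-assoc; +-identityʳ; -‿inverseʳ; *-assoc; *-comm; *-identityˡ; *-identityʳ; zeroˡ; zeroʳ
          ; commutativeSemiring)
  open CommutativeRing ring using (+-isAbelianGroup; *-commutativeMonoid; semiring)
  open CommutativeRingProperties ring public using (cyclic-system)
  open CommutativeRingProperties ring using (×1-homo-^; frobenius-additive)
  open import Algebra.Properties.Semiring.Mult semiring public using (_×_)
  import Algebra.Properties.Semiring.Exp semiring as Exp
  import Algebra.Properties.CommutativeSemiring.Exp commutativeSemiring as CExp
  open CommutativeMonoidSum *-commutativeMonoid using ()
    renaming ( sum to ∏; sum-cong-≗ to ∏-cong-≗; sum-remove to ∏-remove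
             ; ∑-distrib-+ to ∏-distrib-*; sum-replicate to ∏-replicate)
  open ≡-Reasoning

  ^≡^ : ∀ x n → x ^ n ≡ x Exp.^ n
  ^≡^ x zero    = refl
  ^≡^ x (suc n) = cong (x *_) (^≡^ x n)

  ^-+ : ∀ x m n → x ^ (m ℕ.+ n) ≡ x ^ m * x ^ n
  ^-+ x m n rewrite ^≡^ x (m ℕ.+ n) | ^≡^ x m | ^≡^ x n = Exp.^-homo-* x m n

  ^-* : ∀ x m n → x ^ (m ℕ.* n) ≡ (x ^ m) ^ n
  ^-* x m n rewrite ^≡^ x (m ℕ.* n) | ^≡^ (x ^ m) n | ^≡^ x m = sym (Exp.^-assocʳ x m n)

  *-^ : ∀ x y n → (x * y) ^ n ≡ x ^ n * y ^ n
  *-^ x y n rewrite ^≡^ (x * y) n | ^≡^ x n | ^≡^ y n = CExp.^-distrib-* x y n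

  Additive : ℕ → Set
  Additive m = ∀ x y → (x + y) ^ m ≡ x ^ m + y ^ m

  Additive-^ : ∀ {m} → Additive m → ∀ e → Additive (m ℕ.^ e)
  Additive-^ _ zero x y = trans (*-identityʳ (x + y)) (sym (cong₂ _+_ (*-identityʳ x) (*-identityʳ y)))
  Additive-^ {m} m-additive (suc e) x y = begin
    (x + y) ^ (m ℕ.* m ℕ.^ e)              ≡⟨ ^-* (x + y) m (m ℕ.^ e) ⟩
    ((x + y) ^ m) ^ (m ℕ.^ e)              ≡⟨ cong (_^ (m ℕ.^ e)) (m-additive x y) ⟩
    (x ^ m + y ^ m) ^ (m ℕ.^ e)            ≡⟨ Additive-^ m-additive e (x ^ m) (y ^ m) ⟩
    (x ^ m) ^ (m ℕ.^ e) + (y ^ m) ^ (m ℕ.^ e) ≡⟨ sym (cong₂ _+_ (^-* x m (m ℕ.^ e)) (^-* y m (m ℕ.^ e))) ⟩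
    x ^ (m ℕ.* m ℕ.^ e) + y ^ (m ℕ.* m ℕ.^ e) ∎

  Additive-prime : ∀ {p} → Prime p → p × 1# ≡ 0# → Additive p
  Additive-prime {p} p-prime char x y
    rewrite ^≡^ (x + y) p | ^≡^ x p | ^≡^ y p = frobenius-additive p-prime char x y

  _≟_ : DecidableEquality Carrier
  x ≟ y with to card x Fin.≟ to card y
  ... | yes eq = yes (trans (sym (strictlyInverseʳ card x)) (trans (cong (from card) eq) (strictlyInverseʳ card y)))
  ... | no neq = no (neq ∘ cong (to card))

  x*y*y⁻¹≡x : ∀ {x y} → y ≢ 0# → x * y * y ⁻¹ ≡ x
  x*y*y⁻¹≡x {x} {y} y≢0 = trans (*-assoc x y (y ⁻¹)) (trans (cong (x *_) (⁻¹-inverse y y≢0)) (*-identityʳ x))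

  x*y⁻¹*y≡x : ∀ {x y} → y ≢ 0# → x * y ⁻¹ * y ≡ x
  x*y⁻¹*y≡x {x} {y} y≢0 = begin
    x * y ⁻¹ * y        ≡⟨ *-assoc x (y ⁻¹) y ⟩
    x * (y ⁻¹ * y)      ≡⟨ cong (x *_) (*-comm (y ⁻¹) y) ⟩
    x * (y * y ⁻¹)      ≡⟨ sym (*-assoc x y (y ⁻¹)) ⟩
    x * y * y ⁻¹        ≡⟨ x*y*y⁻¹≡x y≢0 ⟩
    x                   ∎

  *-cancelʳ-≡ : ∀ {a b c} → c ≢ 0# → a * c ≡ b * c → a ≡ b
  *-cancelʳ-≡ {a} {b} {c} c≢0 eq =
    trans (sym (x*y*y⁻¹≡x c≢0)) (trans (cong (_* c ⁻¹) eq) (x*y*y⁻¹≡x c≢0))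

  *≢0 : ∀ {x y} → x ≢ 0# → y ≢ 0# → x * y ≢ 0#
  *≢0 {x} {y} x≢0 y≢0 xy≡0 = x≢0 (*-cancelʳ-≡ y≢0 (trans xy≡0 (sym (zeroˡ y))))

  ^≢0 : ∀ {x} n → x ≢ 0# → x ^ n ≢ 0#
  ^≢0 zero    x≢0 = 0≢1 ∘ sym
  ^≢0 (suc n) x≢0 = *≢0 x≢0 (^≢0 n x≢0)

  ^≡0⇒≡0 : ∀ {x} n → x ^ n ≡ 0# → x ≡ 0#
  ^≡0⇒≡0 {x} n xⁿ≡0 with x ≟ 0#
  ... | yes x≡0 = x≡0
  ... | no x≢0  = ⊥-elim (^≢0 n x≢0 xⁿ≡0)

  ∏≢0 : ∀ {n} (f : Fin n → Carrier) → (∀ i → f i ≢ 0#) → ∏ f ≢ 0#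
  ∏≢0 {zero}  f f≢0 = 0≢1 ∘ sym
  ∏≢0 {suc n} f f≢0 = *≢0 (f≢0 Fin.zero) (∏≢0 (f ∘ Fin.suc) (f≢0 ∘ Fin.suc))

  0↦1 : Carrier → Carrier
  0↦1 x with x ≟ 0#
  ... | yes _ = 1#
  ... | no _  = x

  0↦1-0 : 0↦1 0# ≡ 1#
  0↦1-0 with 0# ≟ 0#
  ... | yes _  = refl
  ... | no 0≢0 = ⊥-elim (0≢0 refl)

  0↦1-≢0 : ∀ {x} → x ≢ 0# → 0↦1 x ≡ x
  0↦1-≢0 {x} x≢0 with x ≟ 0#
  ... | yes x≡0 = ⊥-elim (x≢0 x≡0)
  ... | no _    = refl

  module _ {M : ℕ} (e : Carrier ↔ Fin (suc M)) where
    private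
      i₀ = to e 0#
      unit : Fin M → Carrier
      unit j = from e (punchIn i₀ j)

    unit≢0 : ∀ j → unit j ≢ 0#
    unit≢0 j u≡0 = Fin.punchInᵢ≢i i₀ j (trans (sym (strictlyInverseˡ e _)) (cong (to e) u≡0))

    ∏-units : ∀ (g : Carrier → Carrier) → g 0# ≡ 1# → ∏ (g ∘ from e) ≡ ∏ (g ∘ unit)
    ∏-units g g0≡1 = begin
      ∏ (g ∘ from e)                       ≡⟨ ∏-remove {i = i₀} (g ∘ from e) ⟩
      g (from e i₀) * ∏ (g ∘ unit)         ≡⟨ cong (_* ∏ (g ∘ unit)) (trans (cong g (strictlyInverseʳ e 0#)) g0≡1) ⟩
      1# * ∏ (g ∘ unit)                    ≡⟨ *-identityˡ _ ⟩
      ∏ (g ∘ unit)                         ∎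

    -- Multiplication by a permutes F and fixes 0, so it permutes the units; their product P
    -- (taken over all of F with 0 replaced by 1) thus satisfies a^M P = P.
    fermat-unit : ∀ {a} → a ≢ 0# → a ^ M ≡ 1#
    fermat-unit {a} a≢0 = *-cancelʳ-≡ (∏≢0 unit unit≢0) (begin
      a ^ M * ∏ unit                       ≡⟨ cong (_* ∏ unit) (trans (^≡^ a M) (sym (∏-replicate M))) ⟩
      ∏ {M} (λ _ → a) * ∏ unit             ≡⟨ sym (∏-distrib-* (λ _ → a) unit) ⟩
      ∏ (λ j → a * unit j)                 ≡⟨ ∏-cong-≗ (λ j → sym (0↦1-≢0 (*≢0 a≢0 (unit≢0 j)))) ⟩
      ∏ (0↦1 ∘ (a *_) ∘ unit)              ≡⟨ sym (∏-units (0↦1 ∘ (a *_)) (trans (cong 0↦1 (zeroʳ a)) 0↦1-0)) ⟩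
      ∏ (0↦1 ∘ (a *_) ∘ from e)            ≡⟨ sym (sum-reindex *-commutativeMonoid e scaling 0↦1) ⟩
      ∏ (0↦1 ∘ from e)                     ≡⟨ ∏-units 0↦1 0↦1-0 ⟩
      ∏ (0↦1 ∘ unit)                       ≡⟨ ∏-cong-≗ (λ j → 0↦1-≢0 (unit≢0 j)) ⟩
      ∏ unit                               ≡⟨ sym (*-identityˡ _) ⟩
      1# * ∏ unit                          ∎)
      where
      a⁻¹*a≡1 : a ⁻¹ * a ≡ 1#
      a⁻¹*a≡1 = trans (*-comm (a ⁻¹) a) (⁻¹-inverse a a≢0)
      scaling : Carrier ↔ Carrier
      scaling = mk↔ₛ′ (a *_) (a ⁻¹ *_)
        (λ y → trans (sym (*-assoc a (a ⁻¹) y)) (trans (cong (_* y) (⁻¹-inverse a a≢0)) (*-identityˡ y)))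
        (λ y → trans (sym (*-assoc (a ⁻¹) a y)) (trans (cong (_* y) a⁻¹*a≡1) (*-identityˡ y)))

  fermat : ∀ {n} → Carrier ↔ Fin n → ∀ x → x ^ n ≡ x
  fermat {zero} e x with to e x
  ... | ()
  fermat {suc M} e x with x ≟ 0#
  ... | yes refl = zeroˡ _
  ... | no x≢0   = trans (cong (x *_) (fermat-unit e x≢0)) (*-identityʳ x)

  card≡p^K⇒p×1≡0 : ∀ {p K} → N ≡ p ℕ.^ K → p × 1# ≡ 0#
  card≡p^K⇒p×1≡0 {p} {K} N≡p^K = ^≡0⇒≡0 K (begin
    (p × 1#) ^ K         ≡⟨ ^≡^ (p × 1#) K ⟩
    (p × 1#) Exp.^ K     ≡⟨ sym (×1-homo-^ p K) ⟩
    (p ℕ.^ K) × 1#       ≡⟨ cong (_× 1#) (sym N≡p^K) ⟩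
    N × 1#               ≡⟨ ×-card≡ε +-isAbelianGroup card 1# ⟩
    0#                   ∎)

module Frobenius {N : ℕ} (F : FiniteField N) (q : ℕ) where
  open FiniteField F
  open FiniteFieldProperties F
  open ≡-Reasoning

  σ : ℕ → Carrier → Carrier
  σ e x = x ^ (q ℕ.^ e)

  σ-σ : ∀ a b x → σ a (σ b x) ≡ σ (a ℕ.+ b) x
  σ-σ a b x = begin
    (x ^ (q ℕ.^ b)) ^ (q ℕ.^ a)    ≡⟨ sym (^-* x (q ℕ.^ b) (q ℕ.^ a)) ⟩
    x ^ (q ℕ.^ b ℕ.* q ℕ.^ a)      ≡⟨ cong (x ^_) (trans (ℕ.*-comm (q ℕ.^ b) (q ℕ.^ a)) (sym (ℕ.^-distribˡ-+-* q a b))) ⟩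
    x ^ (q ℕ.^ (a ℕ.+ b))          ∎

  σ-distrib-* : ∀ e x y → σ e (x * y) ≡ σ e x * σ e y
  σ-distrib-* e x y = *-^ x y (q ℕ.^ e)

  InSubfield-multiple : ∀ {a x} → InSubfield F q a x → ∀ m → InSubfield F q (m ℕ.* a) x
  InSubfield-multiple {a} {x} x∈Fa zero    = *-identityʳ x
  InSubfield-multiple {a} {x} x∈Fa (suc m) = begin
    σ (a ℕ.+ m ℕ.* a) x     ≡⟨ sym (σ-σ a (m ℕ.* a) x) ⟩
    σ a (σ (m ℕ.* a) x)     ≡⟨ cong (σ a) (InSubfield-multiple x∈Fa m) ⟩
    σ a x                   ≡⟨ x∈Fa ⟩
    x                       ∎

  InSubfield-σ : ∀ {a x} e → InSubfield F q a x → InSubfield F q a (σ e x)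
  InSubfield-σ {a} {x} e x∈Fa = begin
    σ a (σ e x)    ≡⟨ σ-σ a e x ⟩
    σ (a ℕ.+ e) x  ≡⟨ cong (λ c → σ c x) (ℕ.+-comm a e) ⟩
    σ (e ℕ.+ a) x  ≡⟨ sym (σ-σ e a x) ⟩
    σ e (σ a x)    ≡⟨ cong (σ e) x∈Fa ⟩
    σ e x          ∎

  InSubfield-suc : ∀ {m x} → InSubfield F q (suc m) x → InSubfield F q m x → InSubfield F q 1 x
  InSubfield-suc {m} {x} x∈F[m+1] x∈Fm = trans (cong (σ 1) (sym x∈Fm)) (trans (σ-σ 1 m x) x∈F[m+1])

  InSubfield-coprime : ∀ {a b x} → Coprime a b → InSubfield F q a x → InSubfield F q b x → InSubfield F q 1 x
  InSubfield-coprime {a} {b} {x} a⊥b x∈Fa x∈Fb with coprime-Bézout a⊥b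
  ... | Bézout.+- u v 1+vb≡ua =
    InSubfield-suc {v ℕ.* b} (subst (λ c → InSubfield F q c x) (sym 1+vb≡ua) (InSubfield-multiple {a} x∈Fa u))
                   (InSubfield-multiple {b} x∈Fb v)
  ... | Bézout.-+ u v 1+ua≡vb =
    InSubfield-suc {u ℕ.* a} (subst (λ c → InSubfield F q c x) (sym 1+ua≡vb) (InSubfield-multiple {b} x∈Fb v))
                   (InSubfield-multiple {a} x∈Fa u)

  module _ (q-additive : Additive q) where

    σ-distrib-+ : ∀ e x y → σ e (x + y) ≡ σ e x + σ e y
    σ-distrib-+ e = Additive-^ q-additive e

    σ-0 : ∀ e → σ e 0# ≡ 0#
    σ-0 e = x+x≈x⇒x≈0 (σ e 0#) (trans (sym (σ-distrib-+ e 0# 0#)) (cong (σ e) (+-identityʳ 0#)))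
      where open RingProperties (CommutativeRing.ring ring) using (x+x≈x⇒x≈0)

module PartiallyScattered {N : ℕ} (F : FiniteField N) (q t s : ℕ) (δ : FiniteField.Carrier F) where
  open FiniteField F
  open FiniteFieldProperties F
  open Frobenius F q
  open import Algebra.Solver.Ring.NaturalCoefficients.Default commutativeSemiring
  open ≡-Reasoning

  L : Carrier → Carrier
  L w = w + σ t w + δ * σ t (σ t w)

  σ-double : ∀ x → σ (2 ℕ.* t) x ≡ σ t (σ t x)
  σ-double x = begin
    σ (2 ℕ.* t) x        ≡⟨ cong (λ c → σ (t ℕ.+ c) x) (ℕ.+-identityʳ t) ⟩
    σ (t ℕ.+ t) x        ≡⟨ sym (σ-σ t t x) ⟩
    σ t (σ t x)          ∎

  fPoly≡L∘σ : ∀ x → fPoly F q t s δ x ≡ L (σ s x)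
  fPoly≡L∘σ x = cong₂ (λ u v → σ s x + u + δ * v) (sym (σ-σ t s x)) (begin
    σ (2 ℕ.* t ℕ.+ s) x          ≡⟨ sym (σ-σ (2 ℕ.* t) s x) ⟩
    σ (2 ℕ.* t) (σ s x)          ≡⟨ σ-double (σ s x) ⟩
    σ t (σ t (σ s x))            ∎)

  module _ (q-additive : Additive q) (σ-period : ∀ x → InSubfield F q (3 ℕ.* t) x) where

    σ-cube : ∀ x → σ t (σ t (σ t x)) ≡ x
    σ-cube x = begin
      σ t (σ t (σ t x))          ≡⟨ cong (σ t) (sym (σ-double x)) ⟩
      σ t (σ (2 ℕ.* t) x)        ≡⟨ σ-σ t (2 ℕ.* t) x ⟩
      σ (3 ℕ.* t) x              ≡⟨ σ-period x ⟩
      x                          ∎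

    σ-preserves-≡0 : ∀ {a b c d} → a + b + c * d ≡ 0# → σ t a + σ t b + σ t c * σ t d ≡ 0#
    σ-preserves-≡0 {a} {b} {c} {d} eq = begin
      σ t a + σ t b + σ t c * σ t d    ≡⟨ cong (σ t a + σ t b +_) (sym (σ-distrib-* t c d)) ⟩
      σ t a + σ t b + σ t (c * d)      ≡⟨ cong (_+ σ t (c * d)) (sym (σ-distrib-+ q-additive t a b)) ⟩
      σ t (a + b) + σ t (c * d)        ≡⟨ sym (σ-distrib-+ q-additive t (a + b) (c * d)) ⟩
      σ t (a + b + c * d)              ≡⟨ cong (σ t) eq ⟩
      σ t 0#                           ≡⟨ σ-0 q-additive t ⟩
      0#                               ∎

    L≢0 : Tr F q t δ - Nm F q t δ ≢ 2# → ∀ {w} → w ≢ 0# → L w ≢ 0#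
    L≢0 Tr−Nm≢2 {w} w≢0 Lw≡0 = Tr−Nm≢2 (begin
      Tr F q t δ - Nm F q t δ                  ≡⟨ cong₂ _-_ Tr≡ Nm≡ ⟩
      (δ + δ₁ + δ₂) - ν                       ≡⟨ cong (_- ν) (*-cancelʳ-≡ w≢0 (cyclic-system Lw≡0 E₁ E₂)) ⟩
      (2# + ν) - ν                            ≡⟨ +-assoc 2# ν (- ν) ⟩
      2# + (ν - ν)                            ≡⟨ cong (2# +_) (-‿inverseʳ ν) ⟩
      2# + 0#                                 ≡⟨ +-identityʳ 2# ⟩
      2#                                      ∎)
      where
      δ₁ = σ t δ
      δ₂ = σ t δ₁
      ν = δ * δ₁ * δ₂
      w₁ = σ t w
      w₂ = σ t w₁
      Tr≡ : Tr F q t δ ≡ δ + δ₁ + δ₂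
      Tr≡ = cong (δ + δ₁ +_) (σ-double δ)
      Nm≡ : Nm F q t δ ≡ ν
      Nm≡ = begin
        δ ^ (1 ℕ.+ q ℕ.^ t ℕ.+ q ℕ.^ (2 ℕ.* t))    ≡⟨ ^-+ δ (1 ℕ.+ q ℕ.^ t) (q ℕ.^ (2 ℕ.* t)) ⟩
        δ ^ (1 ℕ.+ q ℕ.^ t) * σ (2 ℕ.* t) δ        ≡⟨ cong₂ _*_ (^-+ δ 1 (q ℕ.^ t)) (σ-double δ) ⟩
        δ ^ 1 * δ₁ * δ₂                            ≡⟨ cong (λ x → x * δ₁ * δ₂) (*-identityʳ δ) ⟩
        δ * δ₁ * δ₂                                ∎
      E₁ : w₁ + w₂ + δ₁ * w ≡ 0#
      E₁ = subst (λ x → w₁ + w₂ + δ₁ * x ≡ 0#) (σ-cube w) (σ-preserves-≡0 Lw≡0)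
      E₂ : w₂ + w + δ₂ * w₁ ≡ 0#
      E₂ = subst (λ x → w₂ + x + δ₂ * w₁ ≡ 0#) (σ-cube w) (σ-preserves-≡0 E₁)

    L-linear : ∀ {c} → InSubfield F q t c → ∀ w → L (c * w) ≡ c * L w
    L-linear {c} c∈Ft w = begin
      c * w + σ t (c * w) + δ * σ t (σ t (c * w))
        ≡⟨ cong₂ (λ u v → c * w + u + δ * v) (σ-scale w) (trans (cong (σ t) (σ-scale w)) (σ-scale (σ t w))) ⟩
      c * w + c * σ t w + δ * (c * σ t (σ t w))
        ≡⟨ solve 5 (λ c w w₁ w₂ δ → c :* w :+ c :* w₁ :+ δ :* (c :* w₂) := c :* (w :+ w₁ :+ δ :* w₂))
                   refl c w (σ t w) (σ t (σ t w)) δ ⟩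
      c * L w ∎
      where
      σ-scale : ∀ x → σ t (c * x) ≡ c * σ t x
      σ-scale x = trans (σ-distrib-* t c x) (cong (_* σ t x) c∈Ft)

    fPoly-semilinear : ∀ {l} → InSubfield F q t l → ∀ x → fPoly F q t s δ (l * x) ≡ σ s l * fPoly F q t s δ x
    fPoly-semilinear {l} l∈Ft x = begin
      fPoly F q t s δ (l * x)      ≡⟨ fPoly≡L∘σ (l * x) ⟩
      L (σ s (l * x))              ≡⟨ cong L (σ-distrib-* s l x) ⟩
      L (σ s l * σ s x)            ≡⟨ L-linear (InSubfield-σ {t} s l∈Ft) (σ s x) ⟩
      σ s l * L (σ s x)            ≡⟨ cong (σ s l *_) (sym (fPoly≡L∘σ x)) ⟩
      σ s l * fPoly F q t s δ x    ∎

    partially-scattered : Tr F q t δ - Nm F q t δ ≢ 2# → Coprime s t → RPartiallyScattered F q t (fPoly F q t s δ)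
    partially-scattered Tr−Nm≢2 s⊥t y z y≢0 z≢0 fy/y≡fz/z l∈Ft = InSubfield-coprime s⊥t l∈Fs l∈Ft
      where
      f = fPoly F q t s δ
      l = y * z ⁻¹
      fz≢0 : f z ≢ 0#
      fz≢0 fz≡0 = L≢0 Tr−Nm≢2 (^≢0 (q ℕ.^ s) z≢0) (trans (sym (fPoly≡L∘σ z)) fz≡0)
      fy≡l*fz : f y ≡ l * f z
      fy≡l*fz = begin
        f y                  ≡⟨ sym (x*y⁻¹*y≡x y≢0) ⟩
        f y * y ⁻¹ * y       ≡⟨ cong (_* y) fy/y≡fz/z ⟩
        f z * z ⁻¹ * y       ≡⟨ solve 3 (λ a b c → a :* b :* c := c :* b :* a) refl (f z) (z ⁻¹) y ⟩
        l * f z              ∎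
      l∈Fs : InSubfield F q s l
      l∈Fs = *-cancelʳ-≡ fz≢0 (begin
        σ s l * f z          ≡⟨ sym (fPoly-semilinear l∈Ft z) ⟩
        f (l * z)            ≡⟨ cong f (x*y⁻¹*y≡x z≢0) ⟩
        f y                  ≡⟨ fy≡l*fz ⟩
        l * f z              ∎)

open import Data.Nat using (ℕ; _≥_; _*_; _^_)

proposition2p16 : (q t s : ℕ) → IsPrimePower q → t ≥ 2 → s ≥ 1 → Coprime s (3 * t) →
    (F : FiniteField (q ^ (3 * t))) → (δ : FiniteField.Carrier F) →
    FiniteField._-_ F (Tr F q t δ) (Nm F q t δ) ≢ FiniteField.2# F →
    RPartiallyScattered F q t (fPoly F q t s δ)
proposition2p16 q t s (p , k , p-prime , _ , q≡p^k) _ _ s⊥3t F δ Tr−Nm≢2 =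
  PartiallyScattered.partially-scattered F q t s δ q-additive (fermat card) Tr−Nm≢2 s⊥t
  where
  open FiniteField F using (card)
  open FiniteFieldProperties F
  |F|≡p^[k*3t] : q ^ (3 * t) ≡ p ^ (k * (3 * t))
  |F|≡p^[k*3t] = trans (cong (_^ (3 * t)) q≡p^k) (ℕ.^-*-assoc p k (3 * t))
  p-additive : Additive p
  p-additive = Additive-prime p-prime (card≡p^K⇒p×1≡0 {p} {k * (3 * t)} |F|≡p^[k*3t])
  q-additive : Additive q
  q-additive = subst Additive (sym q≡p^k) (Additive-^ p-additive k)
  s⊥t : Coprime s t
  s⊥t (d∣s , d∣t) = s⊥3t (d∣s , ∣-trans d∣t (n∣m*n 3))
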